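{- Let $G$ be a finite bipartite graph with bipartition $(X,Y)$. For any distinct vertices $a,b,c\in X$, if $(a,b)$ and $(a,c)$ are relevant but not in the same implication class, then $(c,b)$ is relevant.
   Context: Two edges $xy,x'y'$ ($x,x'\in X$, $y,y'\in Y$) are independent if $x\ne x'$, $y\ne y'$, $xy'\notin E(G)$ and $x'y\notin E(G)$. Two walks $a_1\dots a_k$, $b_1\dots b_k$ with $a_1,b_1$ in the same part are congruent if for each $i$ the edges $a_ia_{i+1}$ and $b_ib_{i+1}$ are independent. Let $\mathcal F$ be the set of ordered pairs $(a,b)$ of distinct vertices both in $X$ or both in $Y$. For $(a,b),(f,g)\in\mathcal F$, $(a,b)\,\Gamma\,(f,g)$ means there exist congruent walks from $a$ to $f$ and from $b$ to $g$. The implication class of $(a,b)$ is the set of $(f,g)\in\mathcal F$ with $(a,b)\,\Gamma\,(f,g)$; $(a,b)$ is relevant if its implication class contains at least two pairs. -}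

module Defs where

open import Data.Nat using (ℕ)
open import Data.Fin using (Fin)
open import Data.Bool using (Bool; true)
open import Data.Sum using (_⊎_; inj₁; inj₂)
open import Data.Product using (_×_; _,_; Σ; ∃)
open import Data.Empty using (⊥)
open import Data.Unit using (⊤)
open import Relation.Binary.PropositionalEquality using (_≡_; _≢_)
open import Relation.Nullary using (¬_)

-- A finite bipartite graph with bipartition (X , Y), X = Fin m, Y = Fin n,
-- given by its biadjacency matrix: E x y ≡ true iff xy is an edge.
record BipGraph : Set where
  field
    m n : ℕ
    E   : Fin m → Fin n → Bool

module _ (G : BipGraph) where
  open BipGraph G

  V : Set
  V = Fin m ⊎ Fin n

  Adj : V → V → Set
  Adj (inj₁ x) (inj₂ y) = E x y ≡ true
  Adj (inj₂ y) (inj₁ x) = E x y ≡ true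
  Adj _ _ = ⊥

  SamePart : V → V → Set
  SamePart (inj₁ _) (inj₁ _) = ⊤
  SamePart (inj₂ _) (inj₂ _) = ⊤
  SamePart _ _ = ⊥

  IndepXY : Fin m → Fin n → Fin m → Fin n → Set
  IndepXY x y x' y' = (x ≢ x') × (y ≢ y') × ¬ (E x y' ≡ true) × ¬ (E x' y ≡ true)

  IndepStep : V → V → V → V → Set
  IndepStep (inj₁ x) (inj₂ y) (inj₁ x') (inj₂ y') = IndepXY x y x' y'
  IndepStep (inj₂ y) (inj₁ x) (inj₂ y') (inj₁ x') = IndepXY x y x' y'
  IndepStep _ _ _ _ = ⊥

  -- Congruent a b f g : there are congruent walks a = a₁ … a_k = f and
  -- b = b₁ … b_k = g (k ≥ 1), i.e. a_i a_{i+1} and b_i b_{i+1} are independent edges.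
  data Congruent : V → V → V → V → Set where
    here : ∀ {a b} → SamePart a b → Congruent a b a b
    step : ∀ {a a' b b' f g} → SamePart a b → Adj a a' → Adj b b'
         → IndepStep a a' b b' → Congruent a' b' f g → Congruent a b f g

  InF : V × V → Set
  InF (a , b) = SamePart a b × (a ≢ b)

  Γ : V × V → V × V → Set
  Γ (a , b) (f , g) = InF (a , b) × InF (f , g) × Congruent a b f g

  InClass : V × V → V × V → Set
  InClass p q = Γ p q

  Relevant : V × V → Set
  Relevant p = Σ (V × V) λ q → Σ (V × V) λ r → (q ≢ r) × InClass p q × InClass p r

module Submission where

-- For u , v ∈ X write N(u) for the neighbourhood of u.  A
-- nontrivial congruent walk out of (u , v) starts with independent edges
-- u y , v y', so y ∈ N(u) ∖ N(v) and y' ∈ N(v) ∖ N(u); conversely such y , y'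
-- give the two pairs (u , v) and (y , y') in the class of (u , v).  Hence
-- (u , v) is relevant iff N(u) and N(v) are incomparable under inclusion.
--
-- If (c , b) were not relevant, then (decidably, since Y is finite)
-- N(c) ⊆ N(b) or N(b) ⊆ N(c).  In either case relevance of (a , b) and
-- (a , c) provides y ∈ N(a) missed by b and c, and v ∈ N(b) ∩ N(c) missed by a;
-- the congruent walks a y a and b v c then show (a , b) Γ (a , c),
-- contradicting the hypothesis.  So both private neighbours exist and (c , b)
-- is relevant.

open import Defs
open import Data.Bool using (true)
open import Data.Bool.Properties using (_≟_)
open import Data.Empty using (⊥-elim)
open import Data.Fin using (Fin)
open import Data.Fin.Properties using (any?)
open import Data.Product using (_×_; _,_; ∃)
open import Data.Sum using (_⊎_; inj₁; inj₂)
open import Data.Sum.Properties using (inj₁-injective; inj₂-injective)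
open import Data.Unit using (tt)
open import Function using (_∘_)
open import Relation.Binary.PropositionalEquality using (_≡_; _≢_; refl; ≢-sym)
open import Relation.Nullary using (¬_; yes; no)
open import Relation.Nullary.Decidable using (_×-dec_; ¬?; decidable-stable)

module _ (G : BipGraph) where
  open BipGraph G

  Private : Fin m → Fin m → Fin n → Set
  Private u v y = (E u y ≡ true) × ¬ (E v y ≡ true)

  Incomparable : Fin m → Fin m → Set
  Incomparable u v = ∃ (Private u v) × ∃ (Private v u)

  Included : Fin m → Fin m → Set
  Included u w = ∀ y → E u y ≡ true → E w y ≡ true

  private-or-included : ∀ u v → ∃ (Private u v) ⊎ Included u v
  private-or-included u v with any? (λ y → (E u y ≟ true) ×-dec ¬? (E v y ≟ true))
  ... | yes found = inj₁ found
  ... | no none    = inj₂ λ y uy →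
    decidable-stable (E v y ≟ true) (λ ¬vy → none (y , uy , ¬vy))

  private-grow : ∀ {u w x y} → Included u w → Private u x y → Private w x y
  private-grow u⊆w (uy , ¬xy) = u⊆w _ uy , ¬xy

  private-shrink : ∀ {u w x y} → Included u w → Private x w y → Private x u y
  private-shrink u⊆w (xy , ¬wy) = xy , ¬wy ∘ u⊆w _

  edge : ∀ {u w z} → Private u w z → E u z ≡ true
  edge (uz , _) = uz

  private-distinct : ∀ {u w y y'} → Private u w y → Private w u y' → y ≢ y'
  private-distinct (uy , _) (_ , ¬uy') refl = ¬uy' uy

  independent-edges : ∀ {u w y y'} → u ≢ w → Private u w y → Private w u y'
    → IndepXY G u y w y'
  independent-edges u≢w uy∖w@(_ , ¬wy) wy'∖u@(_ , ¬uy') =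
    u≢w , private-distinct uy∖w wy'∖u , ¬uy' , ¬wy

  step-incomparable : ∀ {u v u' v'} → Adj G (inj₁ u) u' → Adj G (inj₁ v) v'
    → IndepStep G (inj₁ u) u' (inj₁ v) v' → Incomparable u v
  step-incomparable {u' = inj₂ y} {v' = inj₂ y'} uy vy' (_ , _ , ¬uy' , ¬vy) =
    (y , uy , ¬vy) , (y' , vy' , ¬uy')
  step-incomparable {u' = inj₁ _} () _ _
  step-incomparable {u' = inj₂ _} {v' = inj₁ _} _ () _

  -- A relevant X-pair has incomparable neighbourhoods: its class holds two
  -- distinct pairs, so not both witnessing walks are trivial.
  relevant⇒incomparable : ∀ {u v} → Relevant G (inj₁ u , inj₁ v) → Incomparable u v
  relevant⇒incomparable (_ , _ , _ , (_ , _ , step _ uu' vv' indep _) , _) =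
    step-incomparable uu' vv' indep
  relevant⇒incomparable (_ , _ , _ , _ , (_ , _ , step _ uu' vv' indep _)) =
    step-incomparable uu' vv' indep
  relevant⇒incomparable (_ , _ , q≢r , (_ , _ , here _) , (_ , _ , here _)) =
    ⊥-elim (q≢r refl)

  -- Distinct X-vertices with incomparable neighbourhoods form a relevant pair:
  -- its class contains (u , v) itself and (y , y') for private neighbours y , y'.
  incomparable⇒relevant : ∀ {u v} → u ≢ v → Incomparable u v
    → Relevant G (inj₁ u , inj₁ v)
  incomparable⇒relevant {u} {v} u≢v ((y , py) , (y' , py')) =
    (inj₁ u , inj₁ v) , (inj₂ y , inj₂ y') , (λ ()) ,
    (uv-in-F , uv-in-F , here tt) ,
    (uv-in-F , (tt , private-distinct py py' ∘ inj₂-injective) , walk)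
    where
    uv-in-F : InF G (inj₁ u , inj₁ v)
    uv-in-F = tt , u≢v ∘ inj₁-injective

    walk : Congruent G (inj₁ u) (inj₁ v) (inj₂ y) (inj₂ y')
    walk = step {a' = inj₂ y} {b' = inj₂ y'} tt (edge py) (edge py')
             (independent-edges u≢v py py') (here tt)

  implied-via-swap : ∀ {a b c y v} → a ≢ b → a ≢ c
    → Private a b y → Private a c y → Private b a v → Private c a v
    → InClass G (inj₁ a , inj₁ b) (inj₁ a , inj₁ c)
  implied-via-swap {a} {b} {c} {y} {v} a≢b a≢c ay∖b ay∖c bv∖a cv∖a =
    (tt , a≢b ∘ inj₁-injective) , (tt , a≢c ∘ inj₁-injective) ,
    step {a' = inj₂ y} {b' = inj₂ v} tt (edge ay∖b) (edge bv∖a)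
      (independent-edges a≢b ay∖b bv∖a)
      (step {a' = inj₁ a} {b' = inj₁ c} tt (edge ay∖b) (edge cv∖a)
        (independent-edges a≢c ay∖c cv∖a) (here tt))

  implied-if-c⊆b : ∀ {a b c} → a ≢ b → a ≢ c → Incomparable a b → Incomparable a c
    → Included c b → InClass G (inj₁ a , inj₁ b) (inj₁ a , inj₁ c)
  implied-if-c⊆b a≢b a≢c ((_ , ay∖b) , _) (_ , (_ , cv∖a)) c⊆b =
    implied-via-swap a≢b a≢c ay∖b (private-shrink c⊆b ay∖b)
      (private-grow c⊆b cv∖a) cv∖a

  implied-if-b⊆c : ∀ {a b c} → a ≢ b → a ≢ c → Incomparable a b → Incomparable a c
    → Included b c → InClass G (inj₁ a , inj₁ b) (inj₁ a , inj₁ c)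
  implied-if-b⊆c a≢b a≢c (_ , (_ , bv∖a)) ((_ , ay∖c) , _) b⊆c =
    implied-via-swap a≢b a≢c (private-shrink b⊆c ay∖c) ay∖c
      bv∖a (private-grow b⊆c bv∖a)

corollary3p3 : (G : BipGraph) (a b c : Fin (BipGraph.m G))
    → a ≢ b → a ≢ c → b ≢ c
    → Relevant G (inj₁ a , inj₁ b) → Relevant G (inj₁ a , inj₁ c)
    → ¬ InClass G (inj₁ a , inj₁ b) (inj₁ a , inj₁ c)
    → Relevant G (inj₁ c , inj₁ b)
corollary3p3 G a b c a≢b a≢c b≢c rel-ab rel-ac not-implied
  with private-or-included G c b | private-or-included G b c
... | inj₁ c∖b | inj₁ b∖c = incomparable⇒relevant G (≢-sym b≢c) (c∖b , b∖c)
... | inj₂ c⊆b | _        = ⊥-elim (not-implied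
  (implied-if-c⊆b G a≢b a≢c (relevant⇒incomparable G rel-ab) (relevant⇒incomparable G rel-ac) c⊆b))
... | inj₁ _   | inj₂ b⊆c = ⊥-elim (not-implied
  (implied-if-b⊆c G a≢b a≢c (relevant⇒incomparable G rel-ab) (relevant⇒incomparable G rel-ac) b⊆c))
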